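{- Let $m=p_1\cdots p_t$ be a product of distinct odd primes, let $\{\mathbf{u}_x,\mathbf{v}_x\in\mathbb{Z}_m^d : x\in\{0,1\}^\ell\}$ be a matching-vector family over $\mathbb{Z}_m^d$, and let $\mathbf{x},\mathbf{y}\in\mathbb{Z}_m^d$ and $a,b\in\{0,1\}^\ell$. Let $g_1=\langle\mathbf{x},\mathbf{v}_a\rangle$, $g_2=\langle\mathbf{y},\mathbf{v}_b\rangle$, and for $i\in[t]$ let $$f_i(X)=X^{g_1g_2\bmod p_i}-X^{(g_1+1)g_2\bmod p_i}-X^{g_1(g_2+1)\bmod p_i}+X^{(g_1+1)(g_2+1)\bmod p_i}\in\mathbb{Z}[X]$$ (exponents in $\{0,\ldots,p_i-1\}$), with $\alpha_iX^{\beta_i}$ its lexicographically first nonzero monomial. Then for any $r,s\in\{0,1\}^\ell$, $$\sum_{\substack{\epsilon_1,\ldots,\epsilon_t,\delta_1,\ldots,\delta_t\in\{0,1\}\\ \langle\mathbf{x}+\epsilon_i\mathbf{u}_a,\mathbf{v}_r\rangle\cdot\langle\mathbf{y}+\delta_i\mathbf{u}_b,\mathbf{v}_s\rangle\equiv\beta_i\pmod{p_i}\ \forall i\in[t]}}(-1)^{\sum_{i\in[t]}(\epsilon_i+\delta_i)}=\begin{cases}\prod_{i\in[t]}\alpha_i & \text{if }(r,s)=(a,b),\\ 0&\text{otherwise.}\end{cases}$$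
   Context: A matching-vector family over $\mathbb{Z}_m^d$ indexed by $\{0,1\}^\ell$ consists of vectors $\mathbf{u}_x,\mathbf{v}_x\in\mathbb{Z}_m^d$ with $\langle\mathbf{u}_x,\mathbf{v}_y\rangle\in\{0,1\}\pmod{p_k}$ for every $k\in[t]$, and $\langle\mathbf{u}_x,\mathbf{v}_y\rangle=1$ in $\mathbb{Z}_m$ iff $x=y$. -}

module Defs where

open import Data.Nat as ℕ using (ℕ; zero; suc; _≡ᵇ_)
open import Data.Nat.DivMod using (_mod_)
open import Data.Fin using (Fin; toℕ) renaming (zero to fzero; suc to fsuc)
open import Data.Bool using (Bool; true; false; if_then_else_; _∧_)
open import Data.Integer as ℤ using (ℤ; 0ℤ; 1ℤ; -1ℤ)
open import Data.Vec using (Vec; []; _∷_; lookup)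
open import Data.List as List using (List; []; _∷_)
open import Data.Product using (_×_)
open import Data.Sum using (_⊎_)
open import Relation.Binary.PropositionalEquality using (_≡_)
open import Function using (_∘_; _⇔_)

-- Total "mod" on ℕ (only ever used with a prime, hence nonzero, modulus;
-- for a nonzero modulus it is the library's _%_).
infixl 7 _％_
_％_ : ℕ → ℕ → ℕ
a ％ zero = a
a ％ suc n = ℕ._%_ a (suc n)

Σℕ : (n : ℕ) → (Fin n → ℕ) → ℕ
Σℕ zero f = 0
Σℕ (suc n) f = f fzero ℕ.+ Σℕ n (f ∘ fsuc)

Πℕ : (n : ℕ) → (Fin n → ℕ) → ℕ
Πℕ zero f = 1
Πℕ (suc n) f = f fzero ℕ.* Πℕ n (f ∘ fsuc)

Πℤ : (n : ℕ) → (Fin n → ℤ) → ℤ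
Πℤ zero f = 1ℤ
Πℤ (suc n) f = f fzero ℤ.* Πℤ n (f ∘ fsuc)

allᵇ : (n : ℕ) → (Fin n → Bool) → Bool
allᵇ zero f = true
allᵇ (suc n) f = f fzero ∧ allᵇ n (f ∘ fsuc)

ZmVec : ℕ → ℕ → Set
ZmVec m d = Fin d → Fin m

addZ : {m : ℕ} → Fin m → Fin m → Fin m
addZ {suc k} a b = (toℕ a ℕ.+ toℕ b) mod suc k

mulZ : {m : ℕ} → ℕ → Fin m → Fin m
mulZ {suc k} c a = (c ℕ.* toℕ a) mod suc k

_+ᵛ_ : {m d : ℕ} → ZmVec m d → ZmVec m d → ZmVec m d
(x +ᵛ y) j = addZ (x j) (y j)

_·ᵛ_ : {m d : ℕ} → ℕ → ZmVec m d → ZmVec m d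
(c ·ᵛ u) j = mulZ c (u j)

⟪_,_⟫ : {m d : ℕ} → ZmVec m d → ZmVec m d → ℕ
⟪_,_⟫ {m} {d} x y = Σℕ d (λ j → toℕ (x j) ℕ.* toℕ (y j)) ％ m

bit : Bool → ℕ
bit false = 0
bit true = 1

IsMVFamily : (t : ℕ) (p : Fin t → ℕ) (m d ℓ : ℕ)
             (u v : Vec Bool ℓ → ZmVec m d) → Set
IsMVFamily t p m d ℓ u v =
  (∀ x y (k : Fin t) → (⟪ u x , v y ⟫ ％ p k ≡ 0) ⊎ (⟪ u x , v y ⟫ ％ p k ≡ 1))
  × (∀ x y → (⟪ u x , v y ⟫ ≡ 1 ％ m) ⇔ (x ≡ y))

-- f(X) = X^{g1 g2 mod q} - X^{(g1+1)g2 mod q} - X^{g1(g2+1) mod q} + X^{(g1+1)(g2+1) mod q},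
-- given by its coefficient function k ↦ [coefficient of X^k]
indℤ : Bool → ℤ
indℤ b = if b then 1ℤ else 0ℤ

fCoeff : (q g₁ g₂ : ℕ) → ℕ → ℤ
fCoeff q g₁ g₂ k =
  indℤ ((g₁ ℕ.* g₂) ％ q ≡ᵇ k)
  ℤ.- indℤ ((suc g₁ ℕ.* g₂) ％ q ≡ᵇ k)
  ℤ.- indℤ ((g₁ ℕ.* suc g₂) ％ q ≡ᵇ k)
  ℤ.+ indℤ ((suc g₁ ℕ.* suc g₂) ％ q ≡ᵇ k)

isZeroℤ : ℤ → Bool
isZeroℤ z = ℤ.∣ z ∣ ≡ᵇ 0

-- largest k < n with c k ≠ 0 (0 if none)
topIdx : ℕ → (ℕ → ℤ) → ℕ
topIdx zero c = 0
topIdx (suc n) c = if isZeroℤ (c n) then topIdx n c else n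

-- β: exponent of the lexicographically first (= leading, highest-degree)
-- nonzero monomial of f; α: its coefficient.  Exponents range over {0,…,q-1}.
βf : (q g₁ g₂ : ℕ) → ℕ
βf q g₁ g₂ = topIdx q (fCoeff q g₁ g₂)

αf : (q g₁ g₂ : ℕ) → ℤ
αf q g₁ g₂ = fCoeff q g₁ g₂ (βf q g₁ g₂)

allBits : (n : ℕ) → List (Vec Bool n)
allBits zero = [] ∷ []
allBits (suc n) = List.map (false ∷_) (allBits n) List.++ List.map (true ∷_) (allBits n)

sgn : ℕ → ℤ
sgn zero = 1ℤ
sgn (suc n) = ℤ.- sgn n

sumℤ : List ℤ → ℤ
sumℤ = List.foldr ℤ._+_ 0ℤ

lhsSum : (t : ℕ) (p : Fin t → ℕ) {m d ℓ : ℕ} (u v : Vec Bool ℓ → ZmVec m d)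
         (x y : ZmVec m d) (a b r s : Vec Bool ℓ) → ℤ
lhsSum t p u v x y a b r s =
  sumℤ (List.concatMap (λ ε → List.map (λ δ → term ε δ) (allBits t)) (allBits t))
  where
  g₁ = ⟪ x , v a ⟫
  g₂ = ⟪ y , v b ⟫
  cond : Vec Bool t → Vec Bool t → Bool
  cond ε δ = allᵇ t (λ i →
    (⟪ x +ᵛ (bit (lookup ε i) ·ᵛ u a) , v r ⟫ ℕ.* ⟪ y +ᵛ (bit (lookup δ i) ·ᵛ u b) , v s ⟫) ％ p i
      ≡ᵇ βf (p i) g₁ g₂)
  term : Vec Bool t → Vec Bool t → ℤ
  term ε δ = if cond ε δ
    then sgn (Σℕ t (λ i → bit (lookup ε i) ℕ.+ bit (lookup δ i)))
    else 0ℤ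

-- The condition in the sum is a conjunction over the primes and the sign is a product, so the
-- sum factorises as ∏ᵢ Σ_{e,d ∈ {0,1}} [X(e)·Y(d) ≡ βᵢ (mod pᵢ)] (-1)^(e+d), where
-- X(e) = ⟨x + e·u_a, v_r⟩ ≡ ⟨x, v_r⟩ + e·⟨u_a, v_r⟩ and Y(d) = ⟨y + d·u_b, v_s⟩ modulo pᵢ.
-- If r ≠ a, then ⟨u_a, v_r⟩ ≠ 1 in Z_m; its residues are 0 or 1, so by the Chinese remainder
-- theorem it is 0 modulo some pᵢ. There X(0) ≡ X(1), the terms with e = 0 and e = 1 cancel and
-- the i-th factor vanishes; likewise if s ≠ b. If (r, s) = (a, b), then X(e) ≡ g₁ + e and
-- Y(d) ≡ g₂ + d, so the i-th factor is the coefficient of X^βᵢ in fᵢ, i.e. αᵢ.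

{-# OPTIONS --safe #-}
module Submission where

open import Defs
open import Data.Nat using (ℕ)
open import Data.Nat.Divisibility using (_∣_)
open import Data.Nat.Primality using (Prime)
open import Data.Fin using (Fin)
open import Data.Bool using (Bool)
open import Data.Vec using (Vec)
open import Data.Integer using (ℤ; 0ℤ)
open import Data.Product using (_×_)
open import Relation.Nullary using (¬_)
open import Relation.Binary.PropositionalEquality using (_≡_)

import Data.Nat as ℕ
open import Data.Nat using (zero; suc)
open import Data.Bool using (true; false; if_then_else_; _∧_)
open import Data.Fin using (toℕ) renaming (zero to fzero; suc to fsuc)
open import Data.Vec using (_∷_; lookup)
open import Data.List using (List; []; _∷_; _++_; map; concatMap)
open import Data.Product using (∃; _,_; proj₁; proj₂)
open import Function using (_∘_; Equivalence)
import Data.Bool.Properties as Bool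
open import Data.Vec.Properties using (≡-dec)
open import Relation.Nullary using (yes; no; contradiction)
open import Relation.Binary.PropositionalEquality
  using (_≢_; refl; sym; trans; cong; cong₂; subst; module ≡-Reasoning)

module _ where
  open import Data.Nat using (_+_; _*_; _%_)
  open import Data.Nat.Properties using (+-identityʳ; *-zeroʳ; *-identityʳ)
  import Data.Nat.DivMod as DivMod
  open DivMod using (%-distribˡ-+; %-distribˡ-*; m∣n⇒o%n%m≡o%m; m%n<n)
  open import Data.Nat.Divisibility using (0∣⇒≡0)
  open import Data.Nat.Tactic.RingSolver using (solve-∀)
  open import Data.Fin.Properties using (toℕ-fromℕ<)
  open import Level using (0ℓ)
  open import Relation.Binary.Bundles using (Setoid)
  open import Relation.Binary.PropositionalEquality using (setoid)
  import Relation.Binary.Construct.On as On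
  import Relation.Binary.Reasoning.Setoid as SetoidReasoning

  infix 4 _≡_mod_
  _≡_mod_ : ℕ → ℕ → ℕ → Set
  a ≡ b mod q = a ％ q ≡ b ％ q

  ≡-mod-setoid : ℕ → Setoid 0ℓ 0ℓ
  ≡-mod-setoid q = On.setoid (setoid ℕ) (_％ q)

  module ≡-mod-Reasoning (q : ℕ) = SetoidReasoning (≡-mod-setoid q)

  +-cong-mod : ∀ q {a a′ b b′} → a ≡ a′ mod q → b ≡ b′ mod q → a + b ≡ a′ + b′ mod q
  +-cong-mod zero    a≡a′ b≡b′ = cong₂ _+_ a≡a′ b≡b′
  +-cong-mod (suc q) {a} {a′} {b} {b′} a≡a′ b≡b′ = begin
    (a + b) % suc q                         ≡⟨ %-distribˡ-+ a b (suc q) ⟩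
    (a % suc q + b % suc q) % suc q         ≡⟨ cong₂ (λ m n → (m + n) % suc q) a≡a′ b≡b′ ⟩
    (a′ % suc q + b′ % suc q) % suc q       ≡⟨ %-distribˡ-+ a′ b′ (suc q) ⟨
    (a′ + b′) % suc q                       ∎
    where open ≡-Reasoning

  *-cong-mod : ∀ q {a a′ b b′} → a ≡ a′ mod q → b ≡ b′ mod q → a * b ≡ a′ * b′ mod q
  *-cong-mod zero    a≡a′ b≡b′ = cong₂ _*_ a≡a′ b≡b′
  *-cong-mod (suc q) {a} {a′} {b} {b′} a≡a′ b≡b′ = begin
    (a * b) % suc q                         ≡⟨ %-distribˡ-* a b (suc q) ⟩
    (a % suc q * (b % suc q)) % suc q       ≡⟨ cong₂ (λ m n → (m * n) % suc q) a≡a′ b≡b′ ⟩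
    (a′ % suc q * (b′ % suc q)) % suc q     ≡⟨ %-distribˡ-* a′ b′ (suc q) ⟨
    (a′ * b′) % suc q                       ∎
    where open ≡-Reasoning

  +-congˡ-mod : ∀ q a {b b′} → b ≡ b′ mod q → a + b ≡ a + b′ mod q
  +-congˡ-mod q a = +-cong-mod q {a} refl

  +-congʳ-mod : ∀ q b {a a′} → a ≡ a′ mod q → a + b ≡ a′ + b mod q
  +-congʳ-mod q b a≡a′ = +-cong-mod q {b = b} a≡a′ refl

  *-congˡ-mod : ∀ q a {b b′} → b ≡ b′ mod q → a * b ≡ a * b′ mod q
  *-congˡ-mod q a = *-cong-mod q {a} refl

  *-congʳ-mod : ∀ q b {a a′} → a ≡ a′ mod q → a * b ≡ a′ * b mod q
  *-congʳ-mod q b a≡a′ = *-cong-mod q {b = b} a≡a′ refl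

  0％n≡0 : ∀ n → 0 ％ n ≡ 0
  0％n≡0 zero    = refl
  0％n≡0 (suc n) = refl

  ∣⇒%≡ : ∀ q k a → q ∣ suc k → a % suc k ≡ a mod q
  ∣⇒%≡ zero    k a 0∣1+k = contradiction (0∣⇒≡0 0∣1+k) λ ()
  ∣⇒%≡ (suc q) k a q∣1+k = m∣n⇒o%n%m≡o%m (suc q) (suc k) a q∣1+k

  ∣⇒toℕ-mod≡ : ∀ q k a → q ∣ suc k → toℕ (a DivMod.mod suc k) ≡ a mod q
  ∣⇒toℕ-mod≡ q k a q∣1+k =
    trans (cong (_％ q) (toℕ-fromℕ< (m%n<n a (suc k)))) (∣⇒%≡ q k a q∣1+k)

  Σℕ-cong-mod : ∀ q d {f g : Fin d → ℕ} → (∀ j → f j ≡ g j mod q) → Σℕ d f ≡ Σℕ d g mod q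
  Σℕ-cong-mod q zero    f≡g = refl
  Σℕ-cong-mod q (suc d) f≡g = +-cong-mod q (f≡g fzero) (Σℕ-cong-mod q d (f≡g ∘ fsuc))

  Σℕ-linear : ∀ d c (f g : Fin d → ℕ) → Σℕ d (λ j → c * f j + g j) ≡ c * Σℕ d f + Σℕ d g
  Σℕ-linear zero    c f g = sym (trans (+-identityʳ (c * 0)) (*-zeroʳ c))
  Σℕ-linear (suc d) c f g = begin
    c * f fzero + g fzero + Σℕ d (λ j → c * f (fsuc j) + g (fsuc j))
      ≡⟨ cong (c * f fzero + g fzero +_) (Σℕ-linear d c (f ∘ fsuc) (g ∘ fsuc)) ⟩
    c * f fzero + g fzero + (c * Σℕ d (f ∘ fsuc) + Σℕ d (g ∘ fsuc))
      ≡⟨ regroup c (f fzero) (g fzero) (Σℕ d (f ∘ fsuc)) (Σℕ d (g ∘ fsuc)) ⟩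
    c * (f fzero + Σℕ d (f ∘ fsuc)) + (g fzero + Σℕ d (g ∘ fsuc)) ∎
    where
    open ≡-Reasoning
    regroup : ∀ c a b m n → c * a + b + (c * m + n) ≡ c * (a + m) + (b + n)
    regroup = solve-∀

  ⟪x+cu,w⟫≡c⟪u,w⟫+⟪x,w⟫ : ∀ q {k d} c (x u w : ZmVec (suc k) d) → q ∣ suc k →
                          ⟪ x +ᵛ (c ·ᵛ u) , w ⟫ ≡ c * ⟪ u , w ⟫ + ⟪ x , w ⟫ mod q
  ⟪x+cu,w⟫≡c⟪u,w⟫+⟪x,w⟫ q {k} {d} c x u w q∣1+k = begin
    ⟪ x +ᵛ (c ·ᵛ u) , w ⟫                  ≈⟨ ∣⇒%≡ q k _ q∣1+k ⟩
    Σℕ d (λ j → toℕ ((x +ᵛ (c ·ᵛ u)) j) * w̄ j) ≈⟨ Σℕ-cong-mod q d coordinate ⟩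
    Σℕ d (λ j → c * (ū j * w̄ j) + x̄ j * w̄ j)   ≡⟨ Σℕ-linear d c _ _ ⟩
    c * Σℕ d (λ j → ū j * w̄ j) + Σℕ d (λ j → x̄ j * w̄ j)
      ≈⟨ +-cong-mod q (*-congˡ-mod q c (∣⇒%≡ q k _ q∣1+k)) (∣⇒%≡ q k _ q∣1+k) ⟨
    c * ⟪ u , w ⟫ + ⟪ x , w ⟫                ∎
    where
    open ≡-mod-Reasoning q
    x̄ ū w̄ : Fin d → ℕ
    x̄ = toℕ ∘ x
    ū = toℕ ∘ u
    w̄ = toℕ ∘ w
    coordinate : ∀ j → toℕ ((x +ᵛ (c ·ᵛ u)) j) * w̄ j ≡ c * (ū j * w̄ j) + x̄ j * w̄ j mod q
    coordinate j = begin
      toℕ ((x +ᵛ (c ·ᵛ u)) j) * w̄ j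
        ≈⟨ *-congʳ-mod q (w̄ j) (∣⇒toℕ-mod≡ q k (x̄ j + toℕ ((c ·ᵛ u) j)) q∣1+k) ⟩
      (x̄ j + toℕ ((c ·ᵛ u) j)) * w̄ j
        ≈⟨ *-congʳ-mod q (w̄ j) (+-congˡ-mod q (x̄ j) (∣⇒toℕ-mod≡ q k (c * ū j) q∣1+k)) ⟩
      (x̄ j + c * ū j) * w̄ j
        ≡⟨ distribute (x̄ j) c (ū j) (w̄ j) ⟩
      c * (ū j * w̄ j) + x̄ j * w̄ j ∎
      where
      distribute : ∀ a c b e → (a + c * b) * e ≡ c * (b * e) + a * e
      distribute = solve-∀

  ⟪u,w⟫≡0⇒⟪x+cu,w⟫≡⟪x+c′u,w⟫ : ∀ q {k d} c c′ (x u w : ZmVec (suc k) d) → q ∣ suc k →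
                               ⟪ u , w ⟫ ≡ 0 mod q →
                               ⟪ x +ᵛ (c ·ᵛ u) , w ⟫ ≡ ⟪ x +ᵛ (c′ ·ᵛ u) , w ⟫ mod q
  ⟪u,w⟫≡0⇒⟪x+cu,w⟫≡⟪x+c′u,w⟫ q c c′ x u w q∣1+k uw≡0 = begin
    ⟪ x +ᵛ (c ·ᵛ u) , w ⟫        ≈⟨ ⟪x+cu,w⟫≡c⟪u,w⟫+⟪x,w⟫ q c x u w q∣1+k ⟩
    c * ⟪ u , w ⟫ + ⟪ x , w ⟫    ≈⟨ +-congʳ-mod q ⟪ x , w ⟫ (*-congˡ-mod q c uw≡0) ⟩
    c * 0 + ⟪ x , w ⟫            ≡⟨ cong (_+ ⟪ x , w ⟫) (trans (*-zeroʳ c) (sym (*-zeroʳ c′))) ⟩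
    c′ * 0 + ⟪ x , w ⟫           ≈⟨ +-congʳ-mod q ⟪ x , w ⟫ (*-congˡ-mod q c′ uw≡0) ⟨
    c′ * ⟪ u , w ⟫ + ⟪ x , w ⟫   ≈⟨ ⟪x+cu,w⟫≡c⟪u,w⟫+⟪x,w⟫ q c′ x u w q∣1+k ⟨
    ⟪ x +ᵛ (c′ ·ᵛ u) , w ⟫       ∎
    where open ≡-mod-Reasoning q

  ⟪u,w⟫≡1⇒⟪x+cu,w⟫≡c+⟪x,w⟫ : ∀ q {k d} c (x u w : ZmVec (suc k) d) → q ∣ suc k →
                            ⟪ u , w ⟫ ≡ 1 % suc k → ⟪ x +ᵛ (c ·ᵛ u) , w ⟫ ≡ c + ⟪ x , w ⟫ mod q
  ⟪u,w⟫≡1⇒⟪x+cu,w⟫≡c+⟪x,w⟫ q {k} c x u w q∣1+k uw≡1 = begin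
    ⟪ x +ᵛ (c ·ᵛ u) , w ⟫        ≈⟨ ⟪x+cu,w⟫≡c⟪u,w⟫+⟪x,w⟫ q c x u w q∣1+k ⟩
    c * ⟪ u , w ⟫ + ⟪ x , w ⟫    ≈⟨ +-congʳ-mod q ⟪ x , w ⟫ (*-congˡ-mod q c uw≡1[q]) ⟩
    c * 1 + ⟪ x , w ⟫            ≡⟨ cong (_+ ⟪ x , w ⟫) (*-identityʳ c) ⟩
    c + ⟪ x , w ⟫                ∎
    where
    open ≡-mod-Reasoning q
    uw≡1[q] : ⟪ u , w ⟫ ≡ 1 mod q
    uw≡1[q] = trans (cong (_％ q) uw≡1) (∣⇒%≡ q k 1 q∣1+k)

module _ where
  open import Data.Nat using (_+_; _*_; _%_; _<_; ≢-nonZero⁻¹; nonTrivial⇒≢1)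
  open import Data.Nat.Properties
    using (*-comm; *-assoc; <⇒≱; <-trans; n<1+n; m*n≡0⇒m≡0∨n≡0; suc-injective)
  open import Data.Nat.DivMod using (m≡m%n+[m/n]*n; _/_; m<n⇒m%n≡m)
  open import Data.Nat.Divisibility using (divides; ∣-trans; ∣⇒≤; ∣1⇒≡1; n∣m*n; 1∣_)
  open import Data.Nat.Primality using (prime⇒nonZero; prime⇒nonTrivial; prime⇒irreducible; euclidsLemma)
  import Data.Fin.Properties as Fin
  open import Data.Sum using (inj₁; inj₂)

  prime≢1 : ∀ {q} → Prime q → q ≢ 1
  prime≢1 q-prime = nonTrivial⇒≢1 {{prime⇒nonTrivial q-prime}}

  Πℕ-primes≢0 : ∀ t (p : Fin t → ℕ) → (∀ i → Prime (p i)) → Πℕ t p ≢ 0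
  Πℕ-primes≢0 (suc t) p prime Π≡0 with m*n≡0⇒m≡0∨n≡0 (p fzero) Π≡0
  ... | inj₁ p₀≡0 = ≢-nonZero⁻¹ (p fzero) {{prime⇒nonZero (prime fzero)}} p₀≡0
  ... | inj₂ Π′≡0 = Πℕ-primes≢0 t (p ∘ fsuc) (prime ∘ fsuc) Π′≡0

  p∣Πℕ : ∀ t (p : Fin t → ℕ) i → p i ∣ Πℕ t p
  p∣Πℕ (suc t) p fzero    = divides (Πℕ t (p ∘ fsuc)) (*-comm (p fzero) _)
  p∣Πℕ (suc t) p (fsuc i) = ∣-trans (p∣Πℕ t (p ∘ fsuc) i) (n∣m*n (p fzero))

  prime∣Πℕ⇒≡ : ∀ t (p : Fin t → ℕ) → (∀ i → Prime (p i)) → ∀ {q} → Prime q → q ∣ Πℕ t p →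
               ∃ λ i → q ≡ p i
  prime∣Πℕ⇒≡ zero    p prime q-prime q∣1 = contradiction (∣1⇒≡1 q∣1) (prime≢1 q-prime)
  prime∣Πℕ⇒≡ (suc t) p prime q-prime q∣Π with euclidsLemma (p fzero) (Πℕ t (p ∘ fsuc)) q-prime q∣Π
  ... | inj₂ q∣Π′ =
    let i , q≡pᵢ = prime∣Πℕ⇒≡ t (p ∘ fsuc) (prime ∘ fsuc) q-prime q∣Π′ in fsuc i , q≡pᵢ
  ... | inj₁ q∣p₀ with prime⇒irreducible (prime fzero) q∣p₀
  ...   | inj₁ q≡1  = contradiction q≡1 (prime≢1 q-prime)
  ...   | inj₂ q≡p₀ = fzero , q≡p₀

  distinctPrimes∣⇒Πℕ∣ : ∀ t (p : Fin t → ℕ) → (∀ i → Prime (p i)) → (∀ i j → p i ≡ p j → i ≡ j) →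
                        ∀ {n} → (∀ i → p i ∣ n) → Πℕ t p ∣ n
  distinctPrimes∣⇒Πℕ∣ zero    p prime distinct {n} p∣n = 1∣ n
  distinctPrimes∣⇒Πℕ∣ (suc t) p prime distinct {n} p∣n =
    p₀Π′∣n (distinctPrimes∣⇒Πℕ∣ t (p ∘ fsuc) (prime ∘ fsuc) distinct′ (p∣n ∘ fsuc))
    where
    Π′ : ℕ
    Π′ = Πℕ t (p ∘ fsuc)
    distinct′ : ∀ i j → p (fsuc i) ≡ p (fsuc j) → i ≡ j
    distinct′ i j pᵢ≡pⱼ = Fin.suc-injective (distinct (fsuc i) (fsuc j) pᵢ≡pⱼ)
    p₀∤Π′ : ¬ p fzero ∣ Π′
    p₀∤Π′ p₀∣Π′ =
      let i , p₀≡pᵢ₊₁ = prime∣Πℕ⇒≡ t (p ∘ fsuc) (prime ∘ fsuc) (prime fzero) p₀∣Π′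
      in Fin.0≢1+n (distinct fzero (fsuc i) p₀≡pᵢ₊₁)
    p₀Π′∣n : Π′ ∣ n → p fzero * Π′ ∣ n
    p₀Π′∣n (divides c n≡cΠ′)
      with euclidsLemma c Π′ (prime fzero) (subst (p fzero ∣_) n≡cΠ′ (p∣n fzero))
    ... | inj₁ (divides c′ c≡c′p₀) =
          divides c′ (trans n≡cΠ′ (trans (cong (_* Π′) c≡c′p₀) (*-assoc c′ (p fzero) Π′)))
    ... | inj₂ p₀∣Π′ = contradiction p₀∣Π′ p₀∤Π′

  1+w％q≡1⇒q∣w : ∀ q w → suc w ％ q ≡ 1 → q ∣ w
  1+w％q≡1⇒q∣w zero    w 1+w≡1 rewrite suc-injective 1+w≡1 = divides 0 refl
  1+w％q≡1⇒q∣w (suc q) w 1+w%q≡1 = divides (suc w / suc q) (suc-injective (begin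
    suc w                                     ≡⟨ m≡m%n+[m/n]*n (suc w) (suc q) ⟩
    suc w % suc q + (suc w / suc q) * suc q   ≡⟨ cong (_+ (suc w / suc q) * suc q) 1+w%q≡1 ⟩
    suc ((suc w / suc q) * suc q)             ∎))
    where open ≡-Reasoning

  ∣∧<⇒≡0 : ∀ {n w} → n ∣ w → w < n → w ≡ 0
  ∣∧<⇒≡0 {w = zero}  _   _   = refl
  ∣∧<⇒≡0 {w = suc w} n∣w w<n = contradiction (∣⇒≤ n∣w) (<⇒≱ w<n)

  ≡1-mod-primes⇒≡1-mod-Πℕ : ∀ t (p : Fin t → ℕ) → (∀ i → Prime (p i)) → (∀ i j → p i ≡ p j → i ≡ j) →
                             ∀ {k} → suc k ≡ Πℕ t p →
                             ∀ {w} → w < suc k → (∀ i → w ％ p i ≡ 1) → w ≡ 1 % suc k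
  ≡1-mod-primes⇒≡1-mod-Πℕ zero    p _ _ refl {zero} _ _ = refl
  ≡1-mod-primes⇒≡1-mod-Πℕ (suc t) p _ _ _    {zero} _ 0≡1 =
    contradiction (trans (sym (0％n≡0 (p fzero))) (0≡1 fzero)) λ ()
  ≡1-mod-primes⇒≡1-mod-Πℕ t p prime distinct {k} 1+k≡Π {suc w} 1+w<1+k 1+w≡1 =
    trans (sym (m<n⇒m%n≡m 1+w<1+k)) (cong (λ n → suc n % suc k) w≡0)
    where
    Π∣w : Πℕ t p ∣ w
    Π∣w = distinctPrimes∣⇒Πℕ∣ t p prime distinct (λ i → 1+w％q≡1⇒q∣w (p i) w (1+w≡1 i))
    w≡0 : w ≡ 0
    w≡0 = ∣∧<⇒≡0 (subst (_∣ w) (sym 1+k≡Π) Π∣w) (<-trans (n<1+n w) 1+w<1+k)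

module MatchingVectorFamily
  (t : ℕ) (p : Fin t → ℕ) {k d ℓ : ℕ}
  (prime : ∀ i → Prime (p i)) (distinct : ∀ i j → p i ≡ p j → i ≡ j) (1+k≡Π : suc k ≡ Πℕ t p)
  (u v : Vec Bool ℓ → ZmVec (suc k) d) (mv : IsMVFamily t p (suc k) d ℓ u v)
  where

  open import Data.Nat using (_+_; _*_; _≟_)
  open import Data.Nat.DivMod using (m%n<n)
  import Data.Fin.Properties as Fin
  open import Data.Sum using (inj₁; inj₂)

  p∣m : ∀ i → p i ∣ suc k
  p∣m i = subst (p i ∣_) (sym 1+k≡Π) (p∣Πℕ t p i)

  ⟪u,v⟫≡1 : ∀ a → ⟪ u a , v a ⟫ ≡ 1 ％ suc k
  ⟪u,v⟫≡1 a = Equivalence.from (proj₂ mv a a) refl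

  ≢⇒∃⟪u,v⟫≡0 : ∀ {a r} → a ≢ r → ∃ λ i → ⟪ u a , v r ⟫ ≡ 0 mod p i
  ≢⇒∃⟪u,v⟫≡0 {a} {r} a≢r with Fin.any? (λ i → ⟪ u a , v r ⟫ ％ p i ≟ 0)
  ... | yes (i , uv≡0) = i , trans uv≡0 (sym (0％n≡0 (p i)))
  ... | no ∄uv≡0 = contradiction (Equivalence.to (proj₂ mv a r) uv≡1) a≢r
    where
    uv≡1-mod-primes : ∀ i → ⟪ u a , v r ⟫ ％ p i ≡ 1
    uv≡1-mod-primes i with proj₁ mv a r i
    ... | inj₁ uv≡0 = contradiction (i , uv≡0) ∄uv≡0
    ... | inj₂ uv≡1 = uv≡1
    uv≡1 : ⟪ u a , v r ⟫ ≡ 1 ％ suc k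
    uv≡1 = ≡1-mod-primes⇒≡1-mod-Πℕ t p prime distinct 1+k≡Π
             (m%n<n (Σℕ d (λ j → toℕ (u a j) * toℕ (v r j))) (suc k)) uv≡1-mod-primes

  ⟪x+eu,v⟫≡e+⟪x,v⟫ : ∀ i x a e → ⟪ x +ᵛ (bit e ·ᵛ u a) , v a ⟫ ≡ bit e + ⟪ x , v a ⟫ mod p i
  ⟪x+eu,v⟫≡e+⟪x,v⟫ i x a e =
    ⟪u,w⟫≡1⇒⟪x+cu,w⟫≡c+⟪x,w⟫ (p i) (bit e) x (u a) (v a) (p∣m i) (⟪u,v⟫≡1 a)

  ⟪x+0u,v⟫≡⟪x+1u,v⟫ : ∀ i x {a r} → ⟪ u a , v r ⟫ ≡ 0 mod p i →
                      ⟪ x +ᵛ (0 ·ᵛ u a) , v r ⟫ ≡ ⟪ x +ᵛ (1 ·ᵛ u a) , v r ⟫ mod p i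
  ⟪x+0u,v⟫≡⟪x+1u,v⟫ i x {a} {r} = ⟪u,w⟫≡0⇒⟪x+cu,w⟫≡⟪x+c′u,w⟫ (p i) 0 1 x (u a) (v r) (p∣m i)

module _ where
  open import Data.Nat using (_≡ᵇ_)
  open import Data.Nat.Properties using (+-suc)
  open import Data.Integer using (_+_; _*_; -_; _-_)
  open import Data.Integer.Properties
    using (+-identityˡ; +-assoc; +-inverseʳ; neg-distrib-+; *-identityˡ; *-zeroˡ; *-zeroʳ;
           *-distribˡ-+; *-distribʳ-+; neg-distribˡ-*)
  open import Data.Integer.Tactic.RingSolver using (solve-∀)
  open import Data.List.Properties using (map-++; map-∘; map-cong)
  open ≡-Reasoning

  sumℤ-++ : (xs ys : List ℤ) → sumℤ (xs ++ ys) ≡ sumℤ xs + sumℤ ys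
  sumℤ-++ []       ys = sym (+-identityˡ (sumℤ ys))
  sumℤ-++ (x ∷ xs) ys = trans (cong (x +_) (sumℤ-++ xs ys)) (sym (+-assoc x (sumℤ xs) (sumℤ ys)))

  sumℤ-concatMap : {A : Set} (f : A → List ℤ) (xs : List A) →
                   sumℤ (concatMap f xs) ≡ sumℤ (map (sumℤ ∘ f) xs)
  sumℤ-concatMap f []       = refl
  sumℤ-concatMap f (x ∷ xs) =
    trans (sumℤ-++ (f x) (concatMap f xs)) (cong (sumℤ (f x) +_) (sumℤ-concatMap f xs))

  sumℤ-map-*ˡ : {A : Set} (c : ℤ) (f : A → ℤ) (xs : List A) →
                sumℤ (map (λ x → c * f x) xs) ≡ c * sumℤ (map f xs)
  sumℤ-map-*ˡ c f []       = sym (*-zeroʳ c)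
  sumℤ-map-*ˡ c f (x ∷ xs) =
    trans (cong (c * f x +_) (sumℤ-map-*ˡ c f xs)) (sym (*-distribˡ-+ c (f x) (sumℤ (map f xs))))

  ΣBits : (t : ℕ) → (Vec Bool t → ℤ) → ℤ
  ΣBits t f = sumℤ (map f (allBits t))

  ΣBits-cong : ∀ t {f g : Vec Bool t → ℤ} → (∀ ε → f ε ≡ g ε) → ΣBits t f ≡ ΣBits t g
  ΣBits-cong t f≗g = cong sumℤ (map-cong f≗g (allBits t))

  ΣBits-*ˡ : ∀ t c (f : Vec Bool t → ℤ) → ΣBits t (λ ε → c * f ε) ≡ c * ΣBits t f
  ΣBits-*ˡ t c f = sumℤ-map-*ˡ c f (allBits t)

  ΣBits-suc : ∀ t (f : Vec Bool (suc t) → ℤ) →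
              ΣBits (suc t) f ≡ ΣBits t (λ ε → f (false ∷ ε)) + ΣBits t (λ ε → f (true ∷ ε))
  ΣBits-suc t f = begin
    sumℤ (map f (map (false ∷_) L ++ map (true ∷_) L))
      ≡⟨ cong sumℤ (map-++ f (map (false ∷_) L) (map (true ∷_) L)) ⟩
    sumℤ (map f (map (false ∷_) L) ++ map f (map (true ∷_) L))
      ≡⟨ sumℤ-++ (map f (map (false ∷_) L)) (map f (map (true ∷_) L)) ⟩
    sumℤ (map f (map (false ∷_) L)) + sumℤ (map f (map (true ∷_) L))
      ≡⟨ cong₂ (λ xs ys → sumℤ xs + sumℤ ys) (map-∘ L) (map-∘ L) ⟨
    ΣBits t (λ ε → f (false ∷ ε)) + ΣBits t (λ ε → f (true ∷ ε)) ∎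
    where
    L : List (Vec Bool t)
    L = allBits t

  ΣBits-Πℤ : ∀ t (f : Fin t → Bool → ℤ) →
             ΣBits t (λ ε → Πℤ t (λ i → f i (lookup ε i))) ≡ Πℤ t (λ i → f i false + f i true)
  ΣBits-Πℤ zero    f = refl
  ΣBits-Πℤ (suc t) f = begin
    ΣBits (suc t) (λ ε → Πℤ (suc t) (λ i → f i (lookup ε i)))
      ≡⟨ ΣBits-suc t _ ⟩
    ΣBits t (λ ε → f₀ false * G ε) + ΣBits t (λ ε → f₀ true * G ε)
      ≡⟨ cong₂ _+_ (ΣBits-*ˡ t (f₀ false) G) (ΣBits-*ˡ t (f₀ true) G) ⟩
    f₀ false * ΣBits t G + f₀ true * ΣBits t G
      ≡⟨ *-distribʳ-+ (ΣBits t G) (f₀ false) (f₀ true) ⟨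
    (f₀ false + f₀ true) * ΣBits t G
      ≡⟨ cong ((f₀ false + f₀ true) *_) (ΣBits-Πℤ t (f ∘ fsuc)) ⟩
    Πℤ (suc t) (λ i → f i false + f i true) ∎
    where
    f₀ : Bool → ℤ
    f₀ = f fzero
    G : Vec Bool t → ℤ
    G ε = Πℤ t (λ i → f (fsuc i) (lookup ε i))

  Σ₂ : (Bool → Bool → ℤ) → ℤ
  Σ₂ k = (k false false + k false true) + (k true false + k true true)

  Σ₂-cong : {k k′ : Bool → Bool → ℤ} → (∀ e d → k e d ≡ k′ e d) → Σ₂ k ≡ Σ₂ k′
  Σ₂-cong k≗k′ = cong₂ _+_ (cong₂ _+_ (k≗k′ false false) (k≗k′ false true))
                           (cong₂ _+_ (k≗k′ true false) (k≗k′ true true))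

  ΣBits²-Πℤ : ∀ t (k : Fin t → Bool → Bool → ℤ) →
              ΣBits t (λ ε → ΣBits t (λ δ → Πℤ t (λ i → k i (lookup ε i) (lookup δ i))))
              ≡ Πℤ t (λ i → Σ₂ (k i))
  ΣBits²-Πℤ t k =
    trans (ΣBits-cong t (λ ε → ΣBits-Πℤ t (λ i → k i (lookup ε i))))
          (ΣBits-Πℤ t (λ i e → k i e false + k i e true))

  Πℤ-cong : ∀ t {f g : Fin t → ℤ} → (∀ i → f i ≡ g i) → Πℤ t f ≡ Πℤ t g
  Πℤ-cong zero    f≗g = refl
  Πℤ-cong (suc t) f≗g = cong₂ _*_ (f≗g fzero) (Πℤ-cong t (f≗g ∘ fsuc))

  Πℤ-≡0 : ∀ t (f : Fin t → ℤ) i → f i ≡ 0ℤ → Πℤ t f ≡ 0ℤ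
  Πℤ-≡0 (suc t) f fzero    f₀≡0 = trans (cong (_* Πℤ t (f ∘ fsuc)) f₀≡0) (*-zeroˡ (Πℤ t (f ∘ fsuc)))
  Πℤ-≡0 (suc t) f (fsuc i) fᵢ≡0 =
    trans (cong (f fzero *_) (Πℤ-≡0 t (f ∘ fsuc) i fᵢ≡0)) (*-zeroʳ (f fzero))

  sgnIf : Bool → ℕ → ℤ
  sgnIf c n = if c then sgn n else 0ℤ

  sgn-+ : ∀ m n → sgn (m ℕ.+ n) ≡ sgn m * sgn n
  sgn-+ zero    n = sym (*-identityˡ (sgn n))
  sgn-+ (suc m) n = trans (cong -_ (sgn-+ m n)) (neg-distribˡ-* (sgn m) (sgn n))

  sgnIf-∧-+ : ∀ b c m n → sgnIf (b ∧ c) (m ℕ.+ n) ≡ sgnIf b m * sgnIf c n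
  sgnIf-∧-+ false c     m n = refl
  sgnIf-∧-+ true  false m n = sym (*-zeroʳ (sgn m))
  sgnIf-∧-+ true  true  m n = sgn-+ m n

  sgnIf-allᵇ-Σℕ : ∀ t (c : Fin t → Bool) (n : Fin t → ℕ) →
                  sgnIf (allᵇ t c) (Σℕ t n) ≡ Πℤ t (λ i → sgnIf (c i) (n i))
  sgnIf-allᵇ-Σℕ zero    c n = refl
  sgnIf-allᵇ-Σℕ (suc t) c n =
    trans (sgnIf-∧-+ (c fzero) (allᵇ t (c ∘ fsuc)) (n fzero) (Σℕ t (n ∘ fsuc)))
          (cong (sgnIf (c fzero) (n fzero) *_) (sgnIf-allᵇ-Σℕ t (c ∘ fsuc) (n ∘ fsuc)))

  sgnIf-suc : ∀ c n → sgnIf c (suc n) ≡ - sgnIf c n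
  sgnIf-suc false n = refl
  sgnIf-suc true  n = refl

  localTerm : (q β : ℕ) (X Y : Bool → ℕ) → Bool → Bool → ℤ
  localTerm q β X Y e d = sgnIf ((X e ℕ.* Y d) ％ q ≡ᵇ β) (bit e ℕ.+ bit d)

  lhsSum≡Πℤ-Σ₂-localTerm :
    ∀ t (p : Fin t → ℕ) {m d ℓ} (u v : Vec Bool ℓ → ZmVec m d) x y (a b r s : Vec Bool ℓ) →
    lhsSum t p u v x y a b r s
    ≡ Πℤ t (λ i → Σ₂ (localTerm (p i) (βf (p i) ⟪ x , v a ⟫ ⟪ y , v b ⟫)
                                (λ e → ⟪ x +ᵛ (bit e ·ᵛ u a) , v r ⟫)
                                (λ e → ⟪ y +ᵛ (bit e ·ᵛ u b) , v s ⟫)))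
  lhsSum≡Πℤ-Σ₂-localTerm t p u v x y a b r s =
    trans (sumℤ-concatMap _ (allBits t))
   (trans (ΣBits-cong t (λ ε → ΣBits-cong t (λ δ → sgnIf-allᵇ-Σℕ t _ _)))
          (ΣBits²-Πℤ t (λ i → localTerm (p i) (βf (p i) ⟪ x , v a ⟫ ⟪ y , v b ⟫) X Y)))
    where
    X Y : Bool → ℕ
    X e = ⟪ x +ᵛ (bit e ·ᵛ u a) , v r ⟫
    Y e = ⟪ y +ᵛ (bit e ·ᵛ u b) , v s ⟫

  Σ₂-antisymˡ : (k : Bool → Bool → ℤ) → (∀ d → k true d ≡ - k false d) → Σ₂ k ≡ 0ℤ
  Σ₂-antisymˡ k k₁≡-k₀ = begin
    (k false false + k false true) + (k true false + k true true)
      ≡⟨ cong (k false false + k false true +_) (cong₂ _+_ (k₁≡-k₀ false) (k₁≡-k₀ true)) ⟩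
    (k false false + k false true) + (- k false false + - k false true)
      ≡⟨ cong (k false false + k false true +_) (neg-distrib-+ (k false false) (k false true)) ⟨
    (k false false + k false true) + - (k false false + k false true)
      ≡⟨ +-inverseʳ (k false false + k false true) ⟩
    0ℤ ∎

  Σ₂-antisymʳ : (k : Bool → Bool → ℤ) → (∀ e → k e true ≡ - k e false) → Σ₂ k ≡ 0ℤ
  Σ₂-antisymʳ k kₑ₁≡-kₑ₀ = cong₂ _+_ (cancel false) (cancel true)
    where
    cancel : ∀ e → k e false + k e true ≡ 0ℤ
    cancel e = trans (cong (k e false +_) (kₑ₁≡-kₑ₀ e)) (+-inverseʳ (k e false))

  Σ₂-sgnIf : (c : Bool → Bool → Bool) →
             Σ₂ (λ e d → sgnIf (c e d) (bit e ℕ.+ bit d))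
             ≡ indℤ (c false false) - indℤ (c true false) - indℤ (c false true) + indℤ (c true true)
  Σ₂-sgnIf c = begin
    (indℤ c₀₀ + sgnIf c₀₁ 1) + (sgnIf c₁₀ 1 + indℤ c₁₁)
      ≡⟨ cong₂ (λ m n → (indℤ c₀₀ + m) + (n + indℤ c₁₁)) (sgnIf-suc c₀₁ 0) (sgnIf-suc c₁₀ 0) ⟩
    (indℤ c₀₀ + - indℤ c₀₁) + (- indℤ c₁₀ + indℤ c₁₁)
      ≡⟨ rearrange (indℤ c₀₀) (indℤ c₀₁) (indℤ c₁₀) (indℤ c₁₁) ⟩
    indℤ c₀₀ - indℤ c₁₀ - indℤ c₀₁ + indℤ c₁₁ ∎
    where
    c₀₀ c₀₁ c₁₀ c₁₁ : Bool
    c₀₀ = c false false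
    c₀₁ = c false true
    c₁₀ = c true false
    c₁₁ = c true true
    rearrange : ∀ a b c d → (a + - b) + (- c + d) ≡ a - c - b + d
    rearrange = solve-∀

  Σ₂-localTerm≡0ˡ : ∀ q β (X Y : Bool → ℕ) → X false ≡ X true mod q → Σ₂ (localTerm q β X Y) ≡ 0ℤ
  Σ₂-localTerm≡0ˡ q β X Y X₀≡X₁ = Σ₂-antisymˡ (localTerm q β X Y) flip
    where
    flip : ∀ d → localTerm q β X Y true d ≡ - localTerm q β X Y false d
    flip d = begin
      sgnIf ((X true ℕ.* Y d) ％ q ≡ᵇ β) (suc (bit d))
        ≡⟨ cong (λ z → sgnIf (z ≡ᵇ β) (suc (bit d))) (*-congʳ-mod q (Y d) X₀≡X₁) ⟨
      sgnIf ((X false ℕ.* Y d) ％ q ≡ᵇ β) (suc (bit d))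
        ≡⟨ sgnIf-suc _ (bit d) ⟩
      - localTerm q β X Y false d ∎

  Σ₂-localTerm≡0ʳ : ∀ q β (X Y : Bool → ℕ) → Y false ≡ Y true mod q → Σ₂ (localTerm q β X Y) ≡ 0ℤ
  Σ₂-localTerm≡0ʳ q β X Y Y₀≡Y₁ = Σ₂-antisymʳ (localTerm q β X Y) flip
    where
    flip : ∀ e → localTerm q β X Y e true ≡ - localTerm q β X Y e false
    flip e = begin
      sgnIf ((X e ℕ.* Y true) ％ q ≡ᵇ β) (bit e ℕ.+ 1)
        ≡⟨ cong₂ (λ z n → sgnIf (z ≡ᵇ β) n) (*-congˡ-mod q (X e) Y₀≡Y₁) (sym (+-suc (bit e) 0)) ⟨
      sgnIf ((X e ℕ.* Y false) ％ q ≡ᵇ β) (suc (bit e ℕ.+ 0))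
        ≡⟨ sgnIf-suc _ (bit e ℕ.+ 0) ⟩
      - localTerm q β X Y e false ∎

  Σ₂-localTerm≡fCoeff : ∀ q β (X Y : Bool → ℕ) g₁ g₂ →
                        (∀ e → X e ≡ bit e ℕ.+ g₁ mod q) → (∀ d → Y d ≡ bit d ℕ.+ g₂ mod q) →
                        Σ₂ (localTerm q β X Y) ≡ fCoeff q g₁ g₂ β
  Σ₂-localTerm≡fCoeff q β X Y g₁ g₂ X≡ Y≡ =
    trans (Σ₂-cong λ e d →
             cong (λ z → sgnIf (z ≡ᵇ β) (bit e ℕ.+ bit d)) (*-cong-mod q (X≡ e) (Y≡ d)))
          (Σ₂-sgnIf (λ e d → ((bit e ℕ.+ g₁) ℕ.* (bit d ℕ.+ g₂)) ％ q ≡ᵇ β))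

lemma3p10 : (t : ℕ) (p : Fin t → ℕ) (m d ℓ : ℕ)
    → (∀ i → Prime (p i)) → (∀ i → ¬ (2 ∣ p i)) → (∀ i j → p i ≡ p j → i ≡ j)
    → m ≡ Πℕ t p
    → (u v : Vec Bool ℓ → ZmVec m d) → IsMVFamily t p m d ℓ u v
    → (x y : ZmVec m d) (a b r s : Vec Bool ℓ)
    → ((r ≡ a × s ≡ b) → lhsSum t p u v x y a b r s ≡ Πℤ t (λ i → αf (p i) ⟪ x , v a ⟫ ⟪ y , v b ⟫))
      × (¬ (r ≡ a × s ≡ b) → lhsSum t p u v x y a b r s ≡ 0ℤ)
lemma3p10 t p zero d ℓ prime _ _ 0≡Π = contradiction (sym 0≡Π) (Πℕ-primes≢0 t p prime)
lemma3p10 t p (suc k) d ℓ prime _ distinct 1+k≡Π u v mv x y a b r s = onDiagonal , offDiagonal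
  where
  open MatchingVectorFamily t p prime distinct 1+k≡Π u v mv

  X Y : Bool → ℕ
  X e = ⟪ x +ᵛ (bit e ·ᵛ u a) , v r ⟫
  Y e = ⟪ y +ᵛ (bit e ·ᵛ u b) , v s ⟫

  β : Fin t → ℕ
  β i = βf (p i) ⟪ x , v a ⟫ ⟪ y , v b ⟫

  factorised : lhsSum t p u v x y a b r s ≡ Πℤ t (λ i → Σ₂ (localTerm (p i) (β i) X Y))
  factorised = lhsSum≡Πℤ-Σ₂-localTerm t p u v x y a b r s

  onDiagonal : r ≡ a × s ≡ b → lhsSum t p u v x y a b r s ≡ Πℤ t (λ i → αf (p i) ⟪ x , v a ⟫ ⟪ y , v b ⟫)
  onDiagonal (refl , refl) = trans factorised (Πℤ-cong t λ i →
    Σ₂-localTerm≡fCoeff (p i) (β i) X Y _ _ (⟪x+eu,v⟫≡e+⟪x,v⟫ i x a) (⟪x+eu,v⟫≡e+⟪x,v⟫ i y b))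

  offDiagonal : ¬ (r ≡ a × s ≡ b) → lhsSum t p u v x y a b r s ≡ 0ℤ
  offDiagonal rs≢ab with ≡-dec Bool._≟_ r a
  ... | no r≢a = let i , uv≡0 = ≢⇒∃⟪u,v⟫≡0 (r≢a ∘ sym) in
    trans factorised (Πℤ-≡0 t _ i (Σ₂-localTerm≡0ˡ (p i) (β i) X Y (⟪x+0u,v⟫≡⟪x+1u,v⟫ i x uv≡0)))
  ... | yes refl = let i , uv≡0 = ≢⇒∃⟪u,v⟫≡0 (λ b≡s → rs≢ab (refl , sym b≡s)) in
    trans factorised (Πℤ-≡0 t _ i (Σ₂-localTerm≡0ʳ (p i) (β i) X Y (⟪x+0u,v⟫≡⟪x+1u,v⟫ i y uv≡0)))
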